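{- Let $i$ and $i'$ be distinct vertices in a quiver $Q$ with large weights, and let $Q'=\mu[i](Q)$. Suppose that: (A) $i$ is an ascent in every cyclic 3-vertex full subquiver of $Q$ that contains it; (B) $i$ is not a sink or source in $Q$; (C) $i$ is not the apex of a vortex in $Q$. Then: $Q'$ has a global descent at $i$ (in particular at a vertex different from $i'$); $Q'$ is vortex-free; and $|b_{uv}(Q)|\le|b_{uv}(Q')|$ for all vertices $u,v$, with at least one strict inequality.
   Context: Quivers are finite directed multigraphs without loops or oriented 2-cycles, encoded by skew-symmetric $B(Q)=(b_{ij})$; mutation at $k$: $b'_{ij}=-b_{ij}$ if $k\in\{i,j\}$, else $b'_{ij}=b_{ij}+\tfrac12(|b_{ik}|b_{kj}+b_{ik}|b_{kj}|)$. Large weights: $|b_{uv}|\ge 2$ for all $u\ne v$. Write $u\dashrightarrow v$ if $b_{uv}\ge 0$; a sink (source) is a vertex $i$ with $v\dashrightarrow i$ ($i\dashrightarrow v$) for all other $v$. Full subquiver = induced subgraph. A 3-vertex quiver is cyclic if it contains an oriented 3-cycle. In a 3-vertex quiver on $\{i,j,k\}$, $i$ is an ascent (descent) if $|b_{jk}(\mu[i](Q))|>|b_{jk}(Q)|$ (resp. $<$). A quiver has a global descent at $v$ if it contains at least one cyclic 3-vertex full subquiver and every such subquiver has descent at $v$. A vortex is a 4-vertex quiver with all weights nonzero, one vertex (the apex) a sink or source, and the remaining three supporting a cyclic 3-vertex subquiver; a quiver is vortex-free if none of its full 4-vertex subquivers is a vortex. -}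

module Defs where

open import Data.Nat using (ℕ)
open import Data.Integer using (ℤ; +_; -_; _+_; _*_; ∣_∣; _≤_; _<_; _/ℕ_)
open import Data.Fin using (Fin; _≟_)
open import Data.Product using (Σ; _×_; _,_)
open import Data.Sum using (_⊎_)
open import Relation.Nullary using (¬_; yes; no)
open import Relation.Binary.PropositionalEquality using (_≡_; _≢_)

Matrix : ℕ → Set
Matrix n = Fin n → Fin n → ℤ

abs : ℤ → ℤ
abs x = + ∣ x ∣

-- Quivers (no loops, no oriented 2-cycles) = skew-symmetric integer matrices.
SkewSymmetric : ∀ {n} → Matrix n → Set
SkewSymmetric {n} B = (i j : Fin n) → B i j ≡ - B j i

LargeWeights : ∀ {n} → Matrix n → Set
LargeWeights {n} B = (u v : Fin n) → u ≢ v → + 2 ≤ abs (B u v)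

-- Matrix mutation at k:
--   b'_ij = -b_ij if k ∈ {i,j}, else b_ij + (|b_ik| b_kj + b_ik |b_kj|)/2
-- (the numerator is always even, so integer division by 2 is exact).
μ : ∀ {n} → Fin n → Matrix n → Matrix n
μ k B i j with k ≟ i | k ≟ j
... | yes _ | _     = - B i j
... | no _  | yes _ = - B i j
... | no _  | no _  = B i j + ((abs (B i k) * B k j + B i k * abs (B k j)) /ℕ 2)

Distinct3 : ∀ {n} → Fin n → Fin n → Fin n → Set
Distinct3 a b c = a ≢ b × b ≢ c × a ≢ c

Cyclic3 : ∀ {n} → Matrix n → Fin n → Fin n → Fin n → Set
Cyclic3 B a b c =
  (+ 0 < B a b × + 0 < B b c × + 0 < B c a) ⊎
  (+ 0 < B a c × + 0 < B c b × + 0 < B b a)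

-- In the 3-vertex full subquiver on {i,j,k}, i is an ascent / descent.
-- (b_jk of the mutated subquiver equals b_jk of the mutated quiver.)
Ascent : ∀ {n} → Matrix n → Fin n → Fin n → Fin n → Set
Ascent B i j k = abs (B j k) < abs (μ i B j k)

Descent : ∀ {n} → Matrix n → Fin n → Fin n → Fin n → Set
Descent B i j k = abs (μ i B j k) < abs (B j k)

DescentAtIn : ∀ {n} → Matrix n → Fin n → Fin n → Fin n → Fin n → Set
DescentAtIn B v a b c =
  (v ≡ a × Descent B a b c) ⊎ (v ≡ b × Descent B b a c) ⊎ (v ≡ c × Descent B c a b)

GlobalDescent : ∀ {n} → Matrix n → Fin n → Set
GlobalDescent {n} B v =
  Σ (Fin n) (λ a → Σ (Fin n) (λ b → Σ (Fin n) (λ c → Distinct3 a b c × Cyclic3 B a b c)))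
  × ((a b c : Fin n) → Distinct3 a b c → Cyclic3 B a b c → DescentAtIn B v a b c)

Vortex : ∀ {n} → Matrix n → Fin n → Fin n → Fin n → Fin n → Set
Vortex B a x y z =
  (a ≢ x × a ≢ y × a ≢ z × Distinct3 x y z)
  × (¬ B a x ≡ + 0 × ¬ B a y ≡ + 0 × ¬ B a z ≡ + 0 ×
     ¬ B x y ≡ + 0 × ¬ B y z ≡ + 0 × ¬ B x z ≡ + 0)
  × ((+ 0 ≤ B x a × + 0 ≤ B y a × + 0 ≤ B z a)
     ⊎ (+ 0 ≤ B a x × + 0 ≤ B a y × + 0 ≤ B a z))
  × Cyclic3 B x y z

VortexFree : ∀ {n} → Matrix n → Set
VortexFree {n} B = (a x y z : Fin n) → ¬ Vortex B a x y z

Sink : ∀ {n} → Matrix n → Fin n → Set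
Sink {n} B i = (v : Fin n) → v ≢ i → + 0 ≤ B v i

Source : ∀ {n} → Matrix n → Fin n → Set
Source {n} B i = (v : Fin n) → v ≢ i → + 0 ≤ B i v

-- Since i is neither a sink nor a source and all weights are nonzero, the other
-- vertices split into in-neighbours and out-neighbours of i. Mutation at i leaves
-- the arrows inside each class unchanged, negates those at i, and replaces b_jk
-- (j in, k out) by b_jk + b_ji b_ik; the ascent hypothesis makes this strictly
-- larger in absolute value and positive. Hence in μ[i](Q) every arrow between the
-- two classes runs from the in-class to the out-class, so an oriented triangle
-- avoiding i would lie inside one class, unchanged by mutation, and would form a
-- vortex with apex i. Every oriented triangle therefore passes through i and one
-- vertex of each class; since mutation is an involution, i is a descent there.
-- An apex outside such a triangle is neither sink nor source, since it sits in one
-- class and the triangle meets the other.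
module Submission where

open import Defs
open import Data.Nat using (ℕ)
open import Data.Integer using (_≤_; _<_)
open import Data.Fin using (Fin)
open import Data.Product using (Σ; _×_)
open import Relation.Nullary using (¬_)
open import Relation.Binary.PropositionalEquality using (_≢_)

import Data.Nat as ℕ
open import Data.Integer using (ℤ; +_; +0; +[1+_]; -_; _+_; _*_; _/ℕ_; 0ℤ; suc; +<+; +≤+; _≤?_)
open import Data.Integer.Properties hiding (_≟_)
open import Data.Integer.DivMod using ([n/ℕd]*d≤n; n<s[n/ℕd]*d)
open import Data.Integer.Tactic.RingSolver using (solve-∀)
open import Data.Fin using (_≟_)
open import Data.Fin.Properties using (¬∀⟶∃¬)
open import Data.Product using (_,_; proj₁; proj₂)
open import Data.Sum using (_⊎_; inj₁; inj₂; [_,_]′; swap)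
import Data.Sum
open import Data.Empty using (⊥; ⊥-elim)
open import Relation.Nullary using (yes; no)
open import Relation.Binary.Definitions using (tri<; tri≈; tri>)
open import Relation.Binary.PropositionalEquality
  using (_≡_; refl; sym; trans; cong; cong₂; subst; subst₂; ≢-sym; module ≡-Reasoning)

open ≡-Reasoning

[i+i]/ℕ2≡i : ∀ i → (i + i) /ℕ 2 ≡ i
[i+i]/ℕ2≡i i = ≤-antisym q≤i (subst (i ≤_) (pred-suc q) (i<j⇒i≤pred[j] i<suc[q]))
  where
  q = (i + i) /ℕ 2
  j+j≡j*2 : ∀ j → j + j ≡ j * + 2
  j+j≡j*2 = solve-∀
  q≤i : q ≤ i
  q≤i = *-cancelʳ-≤-pos q i (+ 2) (subst (q * + 2 ≤_) (j+j≡j*2 i) ([n/ℕd]*d≤n (i + i) 2))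
  i<suc[q] : i < suc q
  i<suc[q] = *-cancelʳ-<-nonNeg (+ 2) (subst (_< suc q * + 2) (j+j≡j*2 i) (n<s[n/ℕd]*d (i + i) 2))

abs-neg : ∀ a → abs (- a) ≡ abs a
abs-neg a = cong +_ (∣-i∣≡∣i∣ a)

abs-nonpos : ∀ {a} → a ≤ 0ℤ → abs a ≡ - a
abs-nonpos {a} a≤0 = trans (sym (abs-neg a)) (0≤i⇒+∣i∣≡i (neg-mono-≤ a≤0))

0<i*j : ∀ {a b} → 0ℤ < a → 0ℤ < b → 0ℤ < a * b
0<i*j {+[1+ _ ]} {+[1+ _ ]} _ _ = +<+ ℕ.z<s
0<i*j {+0} (+<+ ())
0<i*j {+[1+ _ ]} {+0} _ (+<+ ())

i<i+j : ∀ i {j} → 0ℤ < j → i < i + j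
i<i+j i 0<j = subst (_< i + _) (+-identityʳ i) (+-monoʳ-< i 0<j)

abs-+-pos-grows : ∀ c x → 0ℤ < x → (c < 0ℤ → abs c < abs (c + x)) →
                  abs c < abs (c + x) × 0ℤ < c + x
abs-+-pos-grows c x 0<x grows with 0ℤ ≤? c
... | yes 0≤c = subst₂ _<_ (sym (0≤i⇒+∣i∣≡i 0≤c)) (sym (0≤i⇒+∣i∣≡i (<⇒≤ 0<c+x))) (i<i+j c 0<x) , 0<c+x
  where
  0<c+x : 0ℤ < c + x
  0<c+x = ≤-<-trans 0≤c (i<i+j c 0<x)
... | no c≱0 = |c|<|c+x| , ≰⇒> c+x≰0
  where
  c<0 : c < 0ℤ
  c<0 = ≰⇒> c≱0
  |c|<|c+x| : abs c < abs (c + x)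
  |c|<|c+x| = grows c<0
  c+x≰0 : ¬ c + x ≤ 0ℤ
  c+x≰0 c+x≤0 = <-asym |c|<|c+x|
    (subst₂ _<_ (sym (abs-nonpos c+x≤0)) (sym (abs-nonpos (<⇒≤ c<0))) (neg-mono-< (i<i+j c 0<x)))

μ-shift : ℤ → ℤ → ℤ
μ-shift a b = (abs a * b + a * abs b) /ℕ 2

μ-shift-nonneg : ∀ {a b} → 0ℤ ≤ a → 0ℤ ≤ b → μ-shift a b ≡ a * b
μ-shift-nonneg {a} {b} 0≤a 0≤b = begin
  (abs a * b + a * abs b) /ℕ 2 ≡⟨ cong₂ (λ x y → (x * b + a * y) /ℕ 2) (0≤i⇒+∣i∣≡i 0≤a) (0≤i⇒+∣i∣≡i 0≤b) ⟩
  (a * b + a * b) /ℕ 2         ≡⟨ [i+i]/ℕ2≡i (a * b) ⟩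
  a * b                        ∎

μ-shift-nonpos : ∀ {a b} → a ≤ 0ℤ → b ≤ 0ℤ → μ-shift a b ≡ - (a * b)
μ-shift-nonpos {a} {b} a≤0 b≤0 = begin
  (abs a * b + a * abs b) /ℕ 2    ≡⟨ cong₂ (λ x y → (x * b + a * y) /ℕ 2) (abs-nonpos a≤0) (abs-nonpos b≤0) ⟩
  (- a * b + a * - b) /ℕ 2        ≡⟨ cong (_/ℕ 2) (identity a b) ⟩
  (- (a * b) + - (a * b)) /ℕ 2    ≡⟨ [i+i]/ℕ2≡i (- (a * b)) ⟩
  - (a * b)                       ∎
  where
  identity : ∀ x y → - x * y + x * - y ≡ - (x * y) + - (x * y)
  identity = solve-∀

μ-shift-nonneg-nonpos : ∀ {a b} → 0ℤ ≤ a → b ≤ 0ℤ → μ-shift a b ≡ 0ℤ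
μ-shift-nonneg-nonpos {a} {b} 0≤a b≤0 = begin
  (abs a * b + a * abs b) /ℕ 2    ≡⟨ cong₂ (λ x y → (x * b + a * y) /ℕ 2) (0≤i⇒+∣i∣≡i 0≤a) (abs-nonpos b≤0) ⟩
  (a * b + a * - b) /ℕ 2          ≡⟨ cong (_/ℕ 2) (identity a b) ⟩
  0ℤ                              ∎
  where
  identity : ∀ x y → x * y + x * - y ≡ 0ℤ
  identity = solve-∀

μ-shift-comm : ∀ a b → μ-shift a b ≡ μ-shift b a
μ-shift-comm a b = cong (_/ℕ 2) (identity a b (abs a) (abs b))
  where
  identity : ∀ x y |x| |y| → |x| * y + x * |y| ≡ |y| * x + y * |x|
  identity = solve-∀

μ-shift-nonpos-nonneg : ∀ {a b} → a ≤ 0ℤ → 0ℤ ≤ b → μ-shift a b ≡ 0ℤ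
μ-shift-nonpos-nonneg {a} {b} a≤0 0≤b = trans (μ-shift-comm a b) (μ-shift-nonneg-nonpos 0≤b a≤0)

μ-shift-neg : ∀ a b → μ-shift (- a) (- b) ≡ - μ-shift a b
μ-shift-neg a b with ≤-total 0ℤ a | ≤-total 0ℤ b
... | inj₁ 0≤a | inj₁ 0≤b = begin
  μ-shift (- a) (- b) ≡⟨ μ-shift-nonpos (neg-mono-≤ 0≤a) (neg-mono-≤ 0≤b) ⟩
  - (- a * - b)       ≡⟨ cong -_ (identity a b) ⟩
  - (a * b)           ≡⟨ cong -_ (μ-shift-nonneg 0≤a 0≤b) ⟨
  - μ-shift a b       ∎
  where
  identity : ∀ x y → - x * - y ≡ x * y
  identity = solve-∀
... | inj₁ 0≤a | inj₂ b≤0 = trans (μ-shift-nonpos-nonneg (neg-mono-≤ 0≤a) (neg-mono-≤ b≤0))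
                                  (cong -_ (sym (μ-shift-nonneg-nonpos 0≤a b≤0)))
... | inj₂ a≤0 | inj₁ 0≤b = trans (μ-shift-nonneg-nonpos (neg-mono-≤ a≤0) (neg-mono-≤ 0≤b))
                                  (cong -_ (sym (μ-shift-nonpos-nonneg a≤0 0≤b)))
... | inj₂ a≤0 | inj₂ b≤0 = begin
  μ-shift (- a) (- b) ≡⟨ μ-shift-nonneg (neg-mono-≤ a≤0) (neg-mono-≤ b≤0) ⟩
  - a * - b           ≡⟨ identity a b ⟩
  - - (a * b)         ≡⟨ cong -_ (μ-shift-nonpos a≤0 b≤0) ⟨
  - μ-shift a b       ∎
  where
  identity : ∀ x y → - x * - y ≡ - - (x * y)
  identity = solve-∀

module _ {n : ℕ} where

  incident? : ∀ (k u v : Fin n) → (k ≡ u ⊎ k ≡ v) ⊎ (k ≢ u × k ≢ v)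
  incident? k u v with k ≟ u | k ≟ v
  ... | yes k≡u | _ = inj₁ (inj₁ k≡u)
  ... | no _ | yes k≡v = inj₁ (inj₂ k≡v)
  ... | no k≢u | no k≢v = inj₂ (k≢u , k≢v)

  among? : ∀ (k a b c : Fin n) → k ≡ a ⊎ k ≡ b ⊎ k ≡ c ⊎ (k ≢ a × k ≢ b × k ≢ c)
  among? k a b c with k ≟ a | k ≟ b | k ≟ c
  ... | yes k≡a | _ | _ = inj₁ k≡a
  ... | no _ | yes k≡b | _ = inj₂ (inj₁ k≡b)
  ... | no _ | no _ | yes k≡c = inj₂ (inj₂ (inj₁ k≡c))
  ... | no k≢a | no k≢b | no k≢c = inj₂ (inj₂ (inj₂ (k≢a , k≢b , k≢c)))

  μ-incident : ∀ (B : Matrix n) {k u v} → k ≡ u ⊎ k ≡ v → μ k B u v ≡ - B u v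
  μ-incident B {k} {u} {v} k∈uv with k ≟ u | k ≟ v
  ... | yes _ | _ = refl
  ... | no _ | yes _ = refl
  ... | no k≢u | no k≢v = ⊥-elim ([ k≢u , k≢v ]′ k∈uv)

  μ-off : ∀ (B : Matrix n) {k u v} → k ≢ u → k ≢ v → μ k B u v ≡ B u v + μ-shift (B u k) (B k v)
  μ-off B {k} {u} {v} k≢u k≢v with k ≟ u | k ≟ v
  ... | yes k≡u | _ = ⊥-elim (k≢u k≡u)
  ... | no _ | yes k≡v = ⊥-elim (k≢v k≡v)
  ... | no _ | no _ = refl

  μ-involutive : ∀ k (B : Matrix n) u v → μ k (μ k B) u v ≡ B u v
  μ-involutive k B u v with incident? k u v
  ... | inj₁ k∈uv = begin
    μ k (μ k B) u v ≡⟨ μ-incident (μ k B) k∈uv ⟩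
    - μ k B u v     ≡⟨ cong -_ (μ-incident B k∈uv) ⟩
    - - B u v       ≡⟨ neg-involutive (B u v) ⟩
    B u v           ∎
  ... | inj₂ (k≢u , k≢v) = begin
    μ k (μ k B) u v                                      ≡⟨ μ-off (μ k B) k≢u k≢v ⟩
    μ k B u v + μ-shift (μ k B u k) (μ k B k v)          ≡⟨ cong₂ (λ x y → μ k B u v + μ-shift x y) (μ-incident B (inj₂ refl)) (μ-incident B (inj₁ refl)) ⟩
    μ k B u v + μ-shift (- B u k) (- B k v)              ≡⟨ cong₂ _+_ (μ-off B k≢u k≢v) (μ-shift-neg (B u k) (B k v)) ⟩
    (B u v + μ-shift (B u k) (B k v)) + - μ-shift (B u k) (B k v) ≡⟨ cancel (B u v) (μ-shift (B u k) (B k v)) ⟩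
    B u v                                                ∎
    where
    cancel : ∀ x s → (x + s) + - s ≡ x
    cancel = solve-∀

  μ-skew : ∀ k {B : Matrix n} → SkewSymmetric B → SkewSymmetric (μ k B)
  μ-skew k {B} skew u v with incident? k u v
  ... | inj₁ k∈uv = begin
    μ k B u v   ≡⟨ μ-incident B k∈uv ⟩
    - B u v     ≡⟨ cong -_ (skew u v) ⟩
    - - B v u   ≡⟨ cong -_ (μ-incident B (swap k∈uv)) ⟨
    - μ k B v u ∎
  ... | inj₂ (k≢u , k≢v) = begin
    μ k B u v                                        ≡⟨ μ-off B k≢u k≢v ⟩
    B u v + μ-shift (B u k) (B k v)                  ≡⟨ cong₂ _+_ (skew u v) (cong₂ μ-shift (skew u k) (skew k v)) ⟩
    - B v u + μ-shift (- B k u) (- B v k)            ≡⟨ cong (_+_ (- B v u)) (μ-shift-comm (- B k u) (- B v k)) ⟩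
    - B v u + μ-shift (- B v k) (- B k u)            ≡⟨ cong (_+_ (- B v u)) (μ-shift-neg (B v k) (B k u)) ⟩
    - B v u + - μ-shift (B v k) (B k u)              ≡⟨ neg-distrib-+ (B v u) (μ-shift (B v k) (B k u)) ⟨
    - (B v u + μ-shift (B v k) (B k u))              ≡⟨ cong -_ (μ-off B k≢v k≢u) ⟨
    - μ k B v u                                      ∎

  ascent⇒descent : ∀ (B : Matrix n) k u v → Ascent B k u v → Descent (μ k B) k u v
  ascent⇒descent B k u v = subst (λ x → abs x < abs (μ k B u v)) (sym (μ-involutive k B u v))

  abs-skew : ∀ {B : Matrix n} → SkewSymmetric B → ∀ u v → abs (B u v) ≡ abs (B v u)
  abs-skew {B} skew u v = trans (cong abs (skew u v)) (abs-neg (B v u))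

  Cyclic3-rotate : ∀ {B : Matrix n} {a b c} → Cyclic3 B a b c → Cyclic3 B b c a
  Cyclic3-rotate (inj₁ (ab , bc , ca)) = inj₁ (bc , ca , ab)
  Cyclic3-rotate (inj₂ (ac , cb , ba)) = inj₂ (ba , ac , cb)

module Sides {n : ℕ} {B : Matrix n} (skew : SkewSymmetric B) (large : LargeWeights B) (i : Fin n) where

  M : Matrix n
  M = μ i B

  In Out : Fin n → Set
  In v = 0ℤ < B v i
  Out v = 0ℤ < B i v

  Mixed : Fin n → Fin n → Set
  Mixed p q = (In p × Out q) ⊎ (Out p × In q)

  Mixed-sym : ∀ {p q} → Mixed p q → Mixed q p
  Mixed-sym (inj₁ (in-p , out-q)) = inj₂ (out-q , in-p)
  Mixed-sym (inj₂ (out-p , in-q)) = inj₁ (in-q , out-p)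

  negate-pos : ∀ {u v} → 0ℤ < B u v → B v u < 0ℤ
  negate-pos {u} {v} 0<Buv = subst (_< 0ℤ) (sym (skew v u)) (neg-mono-< 0<Buv)

  negate-neg : ∀ {u v} → B u v < 0ℤ → 0ℤ < B v u
  negate-neg {u} {v} Buv<0 = subst (0ℤ <_) (sym (skew v u)) (neg-mono-< Buv<0)

  In-Out-disjoint : ∀ {v} → In v → Out v → ⊥
  In-Out-disjoint in-v out-v = <-asym out-v (negate-pos in-v)

  In⇒≢ : ∀ {v} → In v → i ≢ v
  In⇒≢ in-v refl = In-Out-disjoint in-v in-v

  Out⇒≢ : ∀ {v} → Out v → i ≢ v
  Out⇒≢ out-v refl = In-Out-disjoint out-v out-v

  In-Out-distinct : ∀ {j k} → In j → Out k → Distinct3 i j k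
  In-Out-distinct in-j out-k = In⇒≢ in-j , (λ { refl → In-Out-disjoint in-j out-k }) , Out⇒≢ out-k

  nonzero : ∀ {u v} → u ≢ v → B u v ≢ 0ℤ
  nonzero {u} {v} u≢v Buv≡0 with subst (λ x → + 2 ≤ abs x) Buv≡0 (large u v u≢v)
  ... | +≤+ ()

  side : ∀ v → i ≢ v → In v ⊎ Out v
  side v i≢v with <-cmp 0ℤ (B v i)
  ... | tri< 0<Bvi _ _ = inj₁ 0<Bvi
  ... | tri≈ _ 0≡Bvi _ = ⊥-elim (nonzero (≢-sym i≢v) (sym 0≡Bvi))
  ... | tri> _ _ Bvi<0 = inj₂ (negate-neg Bvi<0)

  μ-row : ∀ v → M i v ≡ - B i v
  μ-row v = μ-incident B (inj₁ refl)

  μ-col : ∀ v → M v i ≡ - B v i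
  μ-col v = μ-incident B (inj₂ refl)

  In⇒μ-row-pos : ∀ {v} → In v → 0ℤ < M i v
  In⇒μ-row-pos {v} in-v = subst (0ℤ <_) (sym (μ-row v)) (neg-mono-< (negate-pos in-v))

  Out⇒μ-col-pos : ∀ {v} → Out v → 0ℤ < M v i
  Out⇒μ-col-pos {v} out-v = subst (0ℤ <_) (sym (μ-col v)) (neg-mono-< (negate-pos out-v))

  Out⇒μ-row-neg : ∀ {v} → Out v → M i v < 0ℤ
  Out⇒μ-row-neg {v} out-v = subst (_< 0ℤ) (sym (μ-row v)) (neg-mono-< out-v)

  In⇒μ-col-neg : ∀ {v} → In v → M v i < 0ℤ
  In⇒μ-col-neg {v} in-v = subst (_< 0ℤ) (sym (μ-col v)) (neg-mono-< in-v)

  μ-row-pos⇒In : ∀ {v} → i ≢ v → 0ℤ < M i v → In v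
  μ-row-pos⇒In {v} i≢v 0<Miv with side v i≢v
  ... | inj₁ in-v = in-v
  ... | inj₂ out-v = ⊥-elim (<-asym 0<Miv (Out⇒μ-row-neg out-v))

  μ-col-pos⇒Out : ∀ {v} → i ≢ v → 0ℤ < M v i → Out v
  μ-col-pos⇒Out {v} i≢v 0<Mvi with side v i≢v
  ... | inj₂ out-v = out-v
  ... | inj₁ in-v = ⊥-elim (<-asym 0<Mvi (In⇒μ-col-neg in-v))

  μ-In-Out : ∀ {j k} → In j → Out k → M j k ≡ B j k + B j i * B i k
  μ-In-Out {j} {k} in-j out-k = trans (μ-off B (In⇒≢ in-j) (Out⇒≢ out-k))
    (cong (_+_ (B j k)) (μ-shift-nonneg (<⇒≤ in-j) (<⇒≤ out-k)))

  μ-same-side : ∀ {j k} → (In j × In k) ⊎ (Out j × Out k) → M j k ≡ B j k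
  μ-same-side {j} {k} (inj₁ (in-j , in-k)) = begin
    M j k                             ≡⟨ μ-off B (In⇒≢ in-j) (In⇒≢ in-k) ⟩
    B j k + μ-shift (B j i) (B i k)   ≡⟨ cong (_+_ (B j k)) (μ-shift-nonneg-nonpos (<⇒≤ in-j) (<⇒≤ (negate-pos in-k))) ⟩
    B j k + 0ℤ                        ≡⟨ +-identityʳ (B j k) ⟩
    B j k                             ∎
  μ-same-side {j} {k} (inj₂ (out-j , out-k)) = begin
    M j k                             ≡⟨ μ-off B (Out⇒≢ out-j) (Out⇒≢ out-k) ⟩
    B j k + μ-shift (B j i) (B i k)   ≡⟨ cong (_+_ (B j k)) (μ-shift-nonpos-nonneg (<⇒≤ (negate-pos out-j)) (<⇒≤ out-k)) ⟩
    B j k + 0ℤ                        ≡⟨ +-identityʳ (B j k) ⟩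
    B j k                             ∎

  Cyclic3-at-i⇒Mixed : ∀ {b c} → i ≢ b → i ≢ c → Cyclic3 M i b c → Mixed b c
  Cyclic3-at-i⇒Mixed i≢b i≢c (inj₁ (ib , _ , ci)) = inj₁ (μ-row-pos⇒In i≢b ib , μ-col-pos⇒Out i≢c ci)
  Cyclic3-at-i⇒Mixed i≢b i≢c (inj₂ (ic , _ , bi)) = inj₂ (μ-col-pos⇒Out i≢b bi , μ-row-pos⇒In i≢c ic)

  ¬Sink⇒Out : ¬ Sink B i → Σ (Fin n) Out
  ¬Sink⇒Out ¬sink with ¬∀⟶∃¬ n (λ v → 0ℤ ≤ B v i) (λ v → 0ℤ ≤? B v i) (λ all → ¬sink (λ v _ → all v))
  ... | v , Bvi≱0 = v , negate-neg (≰⇒> Bvi≱0)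

  ¬Source⇒In : ¬ Source B i → Σ (Fin n) In
  ¬Source⇒In ¬source with ¬∀⟶∃¬ n (λ v → 0ℤ ≤ B i v) (λ v → 0ℤ ≤? B i v) (λ all → ¬source (λ v _ → all v))
  ... | v , Biv≱0 = v , negate-neg (≰⇒> Biv≱0)

  In-Out-witnesses : ¬ Sink B i → ¬ Source B i → Σ (Fin n) λ j → Σ (Fin n) λ k → In j × Out k
  In-Out-witnesses ¬sink ¬source with ¬Source⇒In ¬source | ¬Sink⇒Out ¬sink
  ... | j , in-j | k , out-k = j , k , in-j , out-k

module Ascending {n : ℕ} {B : Matrix n} (skew : SkewSymmetric B) (large : LargeWeights B) {i : Fin n}
  (ascent : (j k : Fin n) → Distinct3 i j k → Cyclic3 B i j k → Ascent B i j k) where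

  open Sides skew large i public

  In-Out-ascent : ∀ {j k} → In j → Out k → Ascent B i j k × 0ℤ < M j k
  In-Out-ascent {j} {k} in-j out-k =
    subst (λ x → abs (B j k) < abs x × 0ℤ < x) (sym (μ-In-Out in-j out-k))
      (abs-+-pos-grows (B j k) (B j i * B i k) (0<i*j in-j out-k) negative-case)
    where
    -- a negative b_jk closes the oriented triangle i → k → j → i
    negative-case : B j k < 0ℤ → abs (B j k) < abs (B j k + B j i * B i k)
    negative-case Bjk<0 = subst (λ x → abs (B j k) < abs x) (μ-In-Out in-j out-k)
      (ascent j k (In-Out-distinct in-j out-k) (inj₂ (out-k , negate-neg Bjk<0 , in-j)))

  Out-In-ascent : ∀ {j k} → Out j → In k → Ascent B i j k × M j k < 0ℤ
  Out-In-ascent {j} {k} out-j in-k with In-Out-ascent in-k out-j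
  ... | |Bkj|<|Mkj| , 0<Mkj =
    subst₂ _<_ (abs-skew skew k j) (abs-skew (μ-skew i skew) k j) |Bkj|<|Mkj| ,
    subst (_< 0ℤ) (sym (μ-skew i skew j k)) (neg-mono-< 0<Mkj)

  Mixed⇒Ascent : ∀ {p q} → Mixed p q → Ascent B i p q
  Mixed⇒Ascent (inj₁ (in-p , out-q)) = proj₁ (In-Out-ascent in-p out-q)
  Mixed⇒Ascent (inj₂ (out-p , in-q)) = proj₁ (Out-In-ascent out-p in-q)

  Out-forward : ∀ {x y} → Out x → i ≢ y → 0ℤ < M x y → Out y
  Out-forward {x} {y} out-x i≢y 0<Mxy with side y i≢y
  ... | inj₁ in-y = ⊥-elim (<-asym 0<Mxy (proj₂ (Out-In-ascent out-x in-y)))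
  ... | inj₂ out-y = out-y

  In-backward : ∀ {x y} → In y → i ≢ x → 0ℤ < M x y → In x
  In-backward {x} {y} in-y i≢x 0<Mxy with side x i≢x
  ... | inj₁ in-x = in-x
  ... | inj₂ out-x = ⊥-elim (<-asym 0<Mxy (proj₂ (Out-In-ascent out-x in-y)))

  OneSide : Fin n → Fin n → Fin n → Set
  OneSide a b c = (In a × In b × In c) ⊎ (Out a × Out b × Out c)

  oriented-cycle-one-side : ∀ {a b c} → i ≢ a → i ≢ b → i ≢ c →
    0ℤ < M a b → 0ℤ < M b c → 0ℤ < M c a → OneSide a b c
  oriented-cycle-one-side {a} i≢a i≢b i≢c ab bc ca with side a i≢a
  ... | inj₁ in-a = let in-c = In-backward in-a i≢c ca in inj₁ (in-a , In-backward in-c i≢b bc , in-c)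
  ... | inj₂ out-a = let out-b = Out-forward out-a i≢b ab in inj₂ (out-a , out-b , Out-forward out-b i≢c bc)

  OneSide-unchanged : ∀ {a b c} → OneSide a b c → M a b ≡ B a b × M b c ≡ B b c × M c a ≡ B c a
  OneSide-unchanged (inj₁ (in-a , in-b , in-c)) =
    μ-same-side (inj₁ (in-a , in-b)) , μ-same-side (inj₁ (in-b , in-c)) , μ-same-side (inj₁ (in-c , in-a))
  OneSide-unchanged (inj₂ (out-a , out-b , out-c)) =
    μ-same-side (inj₂ (out-a , out-b)) , μ-same-side (inj₂ (out-b , out-c)) , μ-same-side (inj₂ (out-c , out-a))

  oriented-cycle-vortex : ∀ {a b c} → Distinct3 a b c → i ≢ a → i ≢ b → i ≢ c →
    0ℤ < M a b → 0ℤ < M b c → 0ℤ < M c a → Vortex B i a b c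
  oriented-cycle-vortex {a} {b} {c} d@(a≢b , b≢c , a≢c) i≢a i≢b i≢c ab bc ca =
    (i≢a , i≢b , i≢c , d) ,
    (nonzero i≢a , nonzero i≢b , nonzero i≢c , nonzero a≢b , nonzero b≢c , nonzero a≢c) ,
    apex , inj₁ (cycle-in-B (OneSide-unchanged sides))
    where
    sides : OneSide a b c
    sides = oriented-cycle-one-side i≢a i≢b i≢c ab bc ca
    apex : (0ℤ ≤ B a i × 0ℤ ≤ B b i × 0ℤ ≤ B c i) ⊎ (0ℤ ≤ B i a × 0ℤ ≤ B i b × 0ℤ ≤ B i c)
    apex = Data.Sum.map (λ (in-a , in-b , in-c) → <⇒≤ in-a , <⇒≤ in-b , <⇒≤ in-c)
                        (λ (out-a , out-b , out-c) → <⇒≤ out-a , <⇒≤ out-b , <⇒≤ out-c) sides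
    cycle-in-B : M a b ≡ B a b × M b c ≡ B b c × M c a ≡ B c a → 0ℤ < B a b × 0ℤ < B b c × 0ℤ < B c a
    cycle-in-B (Mab≡Bab , Mbc≡Bbc , Mca≡Bca) =
      subst (0ℤ <_) Mab≡Bab ab , subst (0ℤ <_) Mbc≡Bbc bc , subst (0ℤ <_) Mca≡Bca ca

  Straddled : Fin n → Fin n → Fin n → Set
  Straddled a b c = (i ≡ a × Mixed b c) ⊎ (i ≡ b × Mixed a c) ⊎ (i ≡ c × Mixed a b)

  Mixed⇒Descent : ∀ p q → Mixed p q → Descent M i p q
  Mixed⇒Descent p q mixed = ascent⇒descent B i p q (Mixed⇒Ascent mixed)

  Straddled⇒DescentAtIn : ∀ a b c → Straddled a b c → DescentAtIn M i a b c
  Straddled⇒DescentAtIn _ b c (inj₁ (refl , mixed)) = inj₁ (refl , Mixed⇒Descent b c mixed)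
  Straddled⇒DescentAtIn a _ c (inj₂ (inj₁ (refl , mixed))) = inj₂ (inj₁ (refl , Mixed⇒Descent a c mixed))
  Straddled⇒DescentAtIn a b _ (inj₂ (inj₂ (refl , mixed))) = inj₂ (inj₂ (refl , Mixed⇒Descent a b mixed))

  apex-not-sink : ∀ {a p q} → i ≢ a → Mixed p q → 0ℤ ≤ M i a → 0ℤ ≤ M p a → 0ℤ ≤ M q a → ⊥
  apex-not-sink {a} i≢a mixed 0≤Mia 0≤Mpa 0≤Mqa with side a i≢a | mixed
  ... | inj₂ out-a | _ = <⇒≱ (Out⇒μ-row-neg out-a) 0≤Mia
  ... | inj₁ in-a | inj₁ (_ , out-q) = <⇒≱ (proj₂ (Out-In-ascent out-q in-a)) 0≤Mqa
  ... | inj₁ in-a | inj₂ (out-p , _) = <⇒≱ (proj₂ (Out-In-ascent out-p in-a)) 0≤Mpa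

  apex-not-source : ∀ {a p q} → i ≢ a → Mixed p q → 0ℤ ≤ M a i → 0ℤ ≤ M a p → 0ℤ ≤ M a q → ⊥
  apex-not-source {a} i≢a mixed 0≤Mai 0≤Map 0≤Maq with side a i≢a | mixed
  ... | inj₁ in-a | _ = <⇒≱ (In⇒μ-col-neg in-a) 0≤Mai
  ... | inj₂ out-a | inj₁ (in-p , _) = <⇒≱ (proj₂ (Out-In-ascent out-a in-p)) 0≤Map
  ... | inj₂ out-a | inj₂ (_ , in-q) = <⇒≱ (proj₂ (Out-In-ascent out-a in-q)) 0≤Maq

  abs-≤-abs-μ : ∀ u v → abs (B u v) ≤ abs (M u v)
  abs-≤-abs-μ u v with incident? i u v
  ... | inj₁ i∈uv = ≤-reflexive (sym (trans (cong abs (μ-incident B i∈uv)) (abs-neg (B u v))))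
  ... | inj₂ (i≢u , i≢v) with side u i≢u | side v i≢v
  ...   | inj₁ in-u | inj₁ in-v = ≤-reflexive (cong abs (sym (μ-same-side (inj₁ (in-u , in-v)))))
  ...   | inj₂ out-u | inj₂ out-v = ≤-reflexive (cong abs (sym (μ-same-side (inj₂ (out-u , out-v)))))
  ...   | inj₁ in-u | inj₂ out-v = <⇒≤ (Mixed⇒Ascent (inj₁ (in-u , out-v)))
  ...   | inj₂ out-u | inj₁ in-v = <⇒≤ (Mixed⇒Ascent (inj₂ (out-u , in-v)))

  module _ (no-vortex : (x y z : Fin n) → ¬ Vortex B i x y z) where

    ¬Cyclic3-avoiding-i : ∀ {a b c} → Distinct3 a b c → i ≢ a → i ≢ b → i ≢ c → ¬ Cyclic3 M a b c
    ¬Cyclic3-avoiding-i {a} {b} {c} d i≢a i≢b i≢c (inj₁ (ab , bc , ca)) =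
      no-vortex a b c (oriented-cycle-vortex d i≢a i≢b i≢c ab bc ca)
    ¬Cyclic3-avoiding-i {a} {b} {c} (a≢b , b≢c , a≢c) i≢a i≢b i≢c (inj₂ (ac , cb , ba)) =
      no-vortex a c b (oriented-cycle-vortex (a≢c , ≢-sym b≢c , a≢b) i≢a i≢c i≢b ac cb ba)

    Cyclic3⇒Straddled : ∀ {a b c} → Distinct3 a b c → Cyclic3 M a b c → Straddled a b c
    Cyclic3⇒Straddled {a} {b} {c} d@(a≢b , b≢c , a≢c) cyclic with among? i a b c
    ... | inj₁ refl = inj₁ (refl , Cyclic3-at-i⇒Mixed a≢b a≢c cyclic)
    ... | inj₂ (inj₁ refl) =
      inj₂ (inj₁ (refl , Mixed-sym (Cyclic3-at-i⇒Mixed b≢c (≢-sym a≢b) (Cyclic3-rotate {B = M} cyclic))))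
    ... | inj₂ (inj₂ (inj₁ refl)) =
      inj₂ (inj₂ (refl , Cyclic3-at-i⇒Mixed (≢-sym a≢c) (≢-sym b≢c) (Cyclic3-rotate {B = M} (Cyclic3-rotate {B = M} cyclic))))
    ... | inj₂ (inj₂ (inj₂ (i≢a , i≢b , i≢c))) = ⊥-elim (¬Cyclic3-avoiding-i d i≢a i≢b i≢c cyclic)

    VortexFree-μ : VortexFree M
    VortexFree-μ a x y z ((a≢x , a≢y , a≢z , d) , _ , apex , cyclic) with Cyclic3⇒Straddled d cyclic | apex
    ... | inj₁ (refl , mixed)         | inj₁ (ix , yx , zx) = apex-not-sink (≢-sym a≢x) mixed ix yx zx
    ... | inj₁ (refl , mixed)         | inj₂ (xi , xy , xz) = apex-not-source (≢-sym a≢x) mixed xi xy xz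
    ... | inj₂ (inj₁ (refl , mixed)) | inj₁ (xi , ii , zi) = apex-not-sink (≢-sym a≢y) mixed ii xi zi
    ... | inj₂ (inj₁ (refl , mixed)) | inj₂ (ix , ii , iz) = apex-not-source (≢-sym a≢y) mixed ii ix iz
    ... | inj₂ (inj₂ (refl , mixed)) | inj₁ (xi , yi , ii) = apex-not-sink (≢-sym a≢z) mixed ii xi yi
    ... | inj₂ (inj₂ (refl , mixed)) | inj₂ (ix , iy , ii) = apex-not-source (≢-sym a≢z) mixed ii ix iy

    GlobalDescent-μ : ∀ {j k} → In j → Out k → GlobalDescent M i
    GlobalDescent-μ {j} {k} in-j out-k =
      (i , j , k , In-Out-distinct in-j out-k ,
       inj₁ (In⇒μ-row-pos in-j , proj₂ (In-Out-ascent in-j out-k) , Out⇒μ-col-pos out-k)) ,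
      λ a b c d cyclic → Straddled⇒DescentAtIn a b c (Cyclic3⇒Straddled d cyclic)

lemma6p8 : {n : ℕ} (B : Matrix n) (i i' : Fin n) →
    SkewSymmetric B → LargeWeights B → i ≢ i' →
    ((j k : Fin n) → Distinct3 i j k → Cyclic3 B i j k → Ascent B i j k) →
    ¬ Sink B i → ¬ Source B i →
    ((x y z : Fin n) → ¬ Vortex B i x y z) →
    GlobalDescent (μ i B) i
    × VortexFree (μ i B)
    × ((u v : Fin n) → abs (B u v) ≤ abs (μ i B u v))
    × Σ (Fin n) (λ u → Σ (Fin n) (λ v → abs (B u v) < abs (μ i B u v)))
lemma6p8 B i _ skew large _ ascent ¬sink ¬source no-vortex =
  let j , k , in-j , out-k = In-Out-witnesses ¬sink ¬source in
  GlobalDescent-μ no-vortex in-j out-k ,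
  VortexFree-μ no-vortex ,
  abs-≤-abs-μ ,
  (j , k , proj₁ (In-Out-ascent in-j out-k))
  where open Ascending skew large ascent
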